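{- Let $G$ be a connected finite simple graph with $n\ge 3$ vertices that admits a realizer of the form $\{\pi_1,\pi_2,\overline{\pi_1},\overline{\pi_2}\}$. Then $G$ has at most $\lfloor \frac{1}{4}n^2+n-2\rfloor$ edges.
   Context: For a finite simple graph $G=(V,E)$, a realizer is a nonempty family $\mathcal{R}$ of linear orders (permutations) of $V$ such that for every edge $S\in E$ and every vertex $x\in V\setminus S$ there is some $\pi\in\mathcal{R}$ with $x>y$ in $\pi$ for every $y\in S$. For a linear order $\pi$, $\overline{\pi}$ denotes its reverse ($x<y$ in $\overline{\pi}$ iff $x>y$ in $\pi$). A graph with a realizer of the form $\{\pi_1,\pi_2,\overline{\pi_1},\overline{\pi_2}\}$ is said to have dimension at most $\langle\!\langle 3\to 4\rangle\!\rangle$. -}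

module Defs where

open import Data.Nat using (ℕ; zero; suc; _<_; _<ᵇ_)
open import Data.Bool using (Bool; true; false; _∧_; if_then_else_)
open import Data.Fin using (Fin; toℕ)
open import Data.Fin.Permutation using (Permutation′; _⟨$⟩ʳ_; _∘ₚ_; reverse)
open import Data.List using (List; []; _∷_; map; allFin)
open import Data.Nat.ListAction using (sum)
open import Data.Empty using (⊥)
open import Data.List.Membership.Propositional using (_∈_)
open import Data.Product using (Σ; _×_; ∃-syntax)
open import Relation.Binary.PropositionalEquality using (_≡_; _≢_)

record SimpleGraph (n : ℕ) : Set where
  field
    adj    : Fin n → Fin n → Bool
    symm   : ∀ u v → adj u v ≡ adj v u
    irrefl : ∀ v → adj v v ≡ false
open SimpleGraph public

Edge : ∀ {n} → SimpleGraph n → Fin n → Fin n → Set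
Edge G u v = adj G u v ≡ true

edgeCount : ∀ {n} → SimpleGraph n → ℕ
edgeCount {n} G =
  sum (map (λ u → sum (map (λ v →
        if (toℕ u <ᵇ toℕ v) ∧ adj G u v then 1 else 0) (allFin n))) (allFin n))

data Walk {n} (G : SimpleGraph n) : Fin n → Fin n → Set where
  here : ∀ {v} → Walk G v v
  step : ∀ {u w v} → Edge G u w → Walk G w v → Walk G u v

Connected : ∀ {n} → SimpleGraph n → Set
Connected {n} G = ∀ (u v : Fin n) → Walk G u v

-- A linear order on Fin n, given by the position map π (a bijection
-- Fin n → Fin n): x is above y in π iff position of y < position of x.
LinearOrder : ℕ → Set
LinearOrder n = Permutation′ n

_>⟨_⟩_ : ∀ {n} → Fin n → LinearOrder n → Fin n → Set
x >⟨ π ⟩ y = toℕ (π ⟨$⟩ʳ y) < toℕ (π ⟨$⟩ʳ x)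

rev : ∀ {n} → LinearOrder n → LinearOrder n
rev π = π ∘ₚ reverse

IsRealizer : ∀ {n} → SimpleGraph n → List (LinearOrder n) → Set
IsRealizer {n} G [] = ⊥
IsRealizer {n} G R@(_ ∷ _) =
  ∀ (u v x : Fin n) → Edge G u v → x ≢ u → x ≢ v →
    ∃[ π ] (π ∈ R × x >⟨ π ⟩ u × x >⟨ π ⟩ v)

Dim3to4 : ∀ {n} → SimpleGraph n → Set
Dim3to4 {n} G = ∃[ π₁ ] ∃[ π₂ ]
  IsRealizer G (π₁ ∷ π₂ ∷ rev π₁ ∷ rev π₂ ∷ [])

-- List the vertices in π₁-order and give each vertex its π₂-position as height. The realizer
-- condition says that no vertex lies strictly inside the box spanned by an edge, i.e. between
-- its ends both in the list and in height. Take consecutive vertices a, b whose heights differ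
-- most. A common neighbour w of a and b to the right of b has height strictly between theirs:
-- otherwise the walk from b to w, which avoids the box of the edge bw, would contain a step
-- longer than the height difference of a and b. The same holds to the left of a. Two common
-- neighbours on one side would put one of them inside the box of an edge of the other, so each
-- side has at most one. Hence deleting a and b from m vertices deletes at most m + 1 edges,
-- and induction gives 4 e + 8 ≤ m² + 4 m.
module Submission where

open import Defs
open import Data.Nat.Properties
  using ( ≤-refl; ≤-trans; ≤-total; ≤-reflexive; ≤-pred; <⇒≤; <⇒≱; <⇒≯; ≤⇒≯; ≮⇒≥; ≤∧≢⇒<
        ; <-irrefl; <-asym; <-trans; <-cmp; n≤0⇒n≡0; n≤1+n; suc-injective
        ; +-mono-≤; +-monoˡ-≤; +-monoʳ-≤; *-monoʳ-≤; *-comm; *-cancelˡ-≡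
        ; ∸-mono; ∸-monoˡ-<; ∸-monoʳ-<; ∸-cancelʳ-<; m+n≤o⇒m≤o∸n
        ; ∣-∣-comm; ∣n-n∣≡0; ∣m-n∣≡0⇒m≡n; m≡n⇒∣m-n∣≡0; m≤n⇒∣m-n∣≡n∸m; m≤n⇒∣n-m∣≡n∸m
        ; <⇒<ᵇ; <ᵇ⇒<; +-commutativeSemigroup; +-0-commutativeMonoid; module ≤-Reasoning)
open import Algebra.Properties.CommutativeSemigroup +-commutativeSemigroup using (interchange)
import Algebra.Properties.CommutativeMonoid.Sum +-0-commutativeMonoid as FinSum
open import Data.Bool using (Bool; true; false; if_then_else_; _∧_)
open import Data.Bool.Properties using () renaming (_≟_ to _≟ᵇ_)
open import Data.Fin using (Fin; toℕ)
open import Data.Fin.Properties using (toℕ-injective; opposite-prop)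
open import Data.Fin.Permutation using (_⟨$⟩ʳ_; _⟨$⟩ˡ_; inverseˡ; inverseʳ; flip)
open import Data.List using (List; []; _∷_; _++_; map; length; tabulate; allFin)
open import Data.List.Properties using (map-++; map-cong; length-++; length-tabulate)
open import Data.List.Relation.Unary.All as All using (All; []; _∷_)
open import Data.List.Relation.Unary.AllPairs using (AllPairs; []; _∷_)
open import Data.List.Relation.Unary.AllPairs.Properties using (tabulate⁺-<)
open import Data.List.Relation.Unary.Any using (here; there)
open import Data.List.Relation.Unary.Linked as Linked using (Linked; [-]; _∷_)
open import Data.List.Relation.Binary.Permutation.Propositional
  using (_↭_; refl; prep; swap; trans; ↭-trans)
open import Data.List.Relation.Binary.Permutation.Propositional.Properties
  using (shift; ↭-length) renaming (map⁺ to ↭-map⁺)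
open import Data.List.Relation.Binary.Sublist.Propositional
  using (_⊆_; []; _∷_; _∷ʳ_; to∈; from∈; minimum; ⊆-refl; ⊆-trans)
open import Data.List.Relation.Binary.Sublist.Propositional.Properties using (∷ˡ⁻; ++⁺; ++⁺ˡ)
open import Data.Nat using (ℕ; zero; suc; _+_; _*_; _∸_; _/_; _<_; _≤_; _<ᵇ_; ∣_-_∣; z≤n; s≤s)
open import Data.Nat.DivMod using (m*n/n≡m; /-monoˡ-≤)
open import Data.Nat.ListAction using (sum)
open import Data.Nat.ListAction.Properties using (sum-↭; sum-++)
open import Data.Nat.Tactic.RingSolver using (solve-∀)
open import Data.Product using (∃₂; _×_; _,_)
open import Data.Sum using (_⊎_; inj₁; inj₂) renaming (swap to ⊎-swap)
open import Function using (id; _∘_; _∘′_)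
open import Relation.Binary.Definitions using (tri<; tri≈; tri>)
open import Relation.Binary.PropositionalEquality as ≡
  using (_≡_; _≢_; refl; sym; cong; cong₂; subst; subst₂; ≢-sym)
open import Relation.Nullary using (¬_; Dec; yes; no; contradiction)
open import Relation.Nullary.Decidable using (_×-dec_)

private
  variable
    A : Set
    x y z : A
    xs ys : List A

Between : ℕ → ℕ → ℕ → Set
Between x y z = (x < y × y < z) ⊎ (z < y × y < x)

Between-sym : ∀ {x y z} → Between x y z → Between z y x
Between-sym (inj₁ (x<y , y<z)) = inj₂ (x<y , y<z)
Between-sym (inj₂ (z<y , y<x)) = inj₁ (z<y , y<x)

max-¬Between : ∀ {x y z} → x < y → z < y → ¬ Between x y z
max-¬Between x<y z<y (inj₁ (_ , y<z)) = <-asym y<z z<y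
max-¬Between x<y z<y (inj₂ (_ , y<x)) = <-asym y<x x<y

min-¬Between : ∀ {x y z} → y < x → y < z → ¬ Between x y z
min-¬Between y<x y<z (inj₁ (x<y , _)) = <-asym x<y y<x
min-¬Between y<x y<z (inj₂ (z<y , _)) = <-asym z<y y<z

Between-split : ∀ {x y z w} → Between x y z → y ≢ w → Between x y w ⊎ Between w y z
Between-split {y = y} {w = w} btw y≢w with <-cmp y w | btw
... | tri< y<w _ _ | inj₁ (x<y , _) = inj₁ (inj₁ (x<y , y<w))
... | tri< y<w _ _ | inj₂ (z<y , _) = inj₂ (inj₂ (z<y , y<w))
... | tri≈ _ y≡w _ | _              = contradiction y≡w y≢w
... | tri> _ _ w<y | inj₁ (_ , y<z) = inj₂ (inj₁ (w<y , y<z))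
... | tri> _ _ w<y | inj₂ (_ , y<x) = inj₁ (inj₂ (w<y , y<x))

Between⇒∣-∣< : ∀ {x y z} → Between x y z → ∣ y - z ∣ < ∣ x - z ∣
Between⇒∣-∣< (inj₁ (x<y , y<z))
  rewrite m≤n⇒∣m-n∣≡n∸m (<⇒≤ y<z) | m≤n⇒∣m-n∣≡n∸m (<⇒≤ (<-trans x<y y<z))
  = ∸-monoʳ-< x<y (<⇒≤ y<z)
Between⇒∣-∣< (inj₂ (z<y , y<x))
  rewrite m≤n⇒∣n-m∣≡n∸m (<⇒≤ z<y) | m≤n⇒∣n-m∣≡n∸m (<⇒≤ (<-trans z<y y<x))
  = ∸-monoˡ-< y<x (<⇒≤ z<y)

∣-∣-mono : ∀ {p x z q} → p ≤ x → x ≤ z → z ≤ q → ∣ x - z ∣ ≤ ∣ p - q ∣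
∣-∣-mono p≤x x≤z z≤q
  rewrite m≤n⇒∣m-n∣≡n∸m x≤z | m≤n⇒∣m-n∣≡n∸m (≤-trans p≤x (≤-trans x≤z z≤q))
  = ∸-mono z≤q p≤x

¬Between⇒outside : ∀ {x y z} → x < z → ¬ Between x y z → y ≤ x ⊎ z ≤ y
¬Between⇒outside {x} {y} x<z ¬btw with <-cmp x y
... | tri< x<y _ _  = inj₂ (≮⇒≥ λ y<z → ¬btw (inj₁ (x<y , y<z)))
... | tri≈ _ refl _ = inj₁ ≤-refl
... | tri> _ _ y<x  = inj₁ (<⇒≤ y<x)

near⇒Between : ∀ {x y z} → x ≢ z → y ≢ z → ¬ Between x y z → ∣ z - y ∣ ≤ ∣ x - y ∣ → Between x z y
near⇒Between {x} {y} {z} x≢z y≢z ¬btw near with <-cmp x y | <-cmp x z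
... | tri< x<y _ _  | tri< x<z _ _ =
  inj₁ (x<z , ≤∧≢⇒< (≮⇒≥ λ y<z → ¬btw (inj₁ (x<y , y<z))) (y≢z ∘ sym))
... | tri> _ _ y<x  | tri> _ _ z<x =
  inj₂ (≤∧≢⇒< (≮⇒≥ λ z<y → ¬btw (inj₂ (z<y , y<x))) y≢z , z<x)
... | tri< x<y _ _  | tri> _ _ z<x = contradiction near (<⇒≱ (Between⇒∣-∣< (inj₁ (z<x , x<y))))
... | tri> _ _ y<x  | tri< x<z _ _ = contradiction near (<⇒≱ (Between⇒∣-∣< (inj₂ (y<x , x<z))))
... | _             | tri≈ _ x≡z _ = contradiction x≡z x≢z
... | tri≈ _ refl _ | _            =
  contradiction (sym (∣m-n∣≡0⇒m≡n (n≤0⇒n≡0 (subst (∣ z - x ∣ ≤_) (∣n-n∣≡0 x) near)))) y≢z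

crossing : ∀ {R : A → A → Set} {P Q : A → Set} →
           Linked R xs → x ∷ z ∷ [] ⊆ xs →
           (∀ {y} → x ∷ y ∷ z ∷ [] ⊆ xs → P y ⊎ Q y) → P x → Q z →
           ∃₂ λ p q → P p × Q q × R p q
crossing [-]          (_ ∷ʳ ())
crossing (_ ∷ steps)  (_ ∷ʳ τ)          P⊎Q px qz = crossing steps τ (P⊎Q ∘′ (_ ∷ʳ_)) px qz
crossing (r ∷ _)      (refl ∷ refl ∷ _) P⊎Q px qz = _ , _ , px , qz , r
crossing (r ∷ steps)  (refl ∷ (_ ∷ʳ τ)) P⊎Q px qz with P⊎Q (refl ∷ refl ∷ τ)
... | inj₂ qy = _ , _ , px , qy , r
... | inj₁ py = crossing steps (refl ∷ τ) (λ σ → P⊎Q (refl ∷ ∷ˡ⁻ σ)) py qz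

record WidestStep (d : A → A → ℕ) (xs : List A) : Set where
  constructor widest
  field
    before  : List A
    a b     : A
    after   : List A
    split   : xs ≡ before ++ a ∷ b ∷ after
    maximal : Linked (λ p q → d p q ≤ d a b) xs

widestStep : ∀ (d : A → A → ℕ) x y zs → WidestStep d (x ∷ y ∷ zs)
widestStep d x y []       = widest [] x y [] refl (≤-refl ∷ [-])
widestStep d x y (z ∷ zs) with widestStep d y z zs
... | widest P a b S eq maximal with ≤-total (d a b) (d x y)
...   | inj₁ ab≤xy =
  widest [] x y (z ∷ zs) refl (≤-refl ∷ Linked.map (λ le → ≤-trans le ab≤xy) maximal)
...   | inj₂ xy≤ab = widest (x ∷ P) a b S (cong (x ∷_) eq) (xy≤ab ∷ maximal)

AllPairs-⊆ : ∀ {R : A → A → Set} → AllPairs R ys → x ∷ y ∷ [] ⊆ ys → R x y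
AllPairs-⊆ (_ ∷ rs) (_ ∷ʳ σ)   = AllPairs-⊆ rs σ
AllPairs-⊆ (r ∷ _)  (refl ∷ σ) = All.lookup r (to∈ σ)

removePair-↭ : ∀ (P : List A) a b S → P ++ a ∷ b ∷ S ↭ a ∷ b ∷ P ++ S
removePair-↭ P a b S = ↭-trans (shift a P (b ∷ S)) (prep a (shift b P S))

sum-map-cong : ∀ {f g : A → ℕ} → All (λ x → f x ≡ g x) xs → sum (map f xs) ≡ sum (map g xs)
sum-map-cong []          = refl
sum-map-cong (fx≡gx ∷ h) = cong₂ _+_ fx≡gx (sum-map-cong h)

position : ∀ {n} → LinearOrder n → Fin n → ℕ
position π v = toℕ (π ⟨$⟩ʳ v)

inOrder : ∀ {n} → LinearOrder n → List (Fin n)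
inOrder π = tabulate (π ⟨$⟩ˡ_)

sum-map-tabulate : ∀ {m} (f : A → ℕ) (g : Fin m → A) →
                   sum (map f (tabulate g)) ≡ FinSum.sum (f ∘ g)
sum-map-tabulate {m = zero}  f g = refl
sum-map-tabulate {m = suc m} f g = cong (f (g Fin.zero) +_) (sum-map-tabulate f (g ∘ Fin.suc))

sum-map-inOrder : ∀ {m} (π : LinearOrder m) (f : Fin m → ℕ) →
                  sum (map f (inOrder π)) ≡ sum (map f (allFin m))
sum-map-inOrder π f = begin
  sum (map f (inOrder π))    ≡⟨ sum-map-tabulate f (π ⟨$⟩ˡ_) ⟩
  FinSum.sum (f ∘ (π ⟨$⟩ˡ_)) ≡⟨ sym (FinSum.sum-permute f (flip π)) ⟩
  FinSum.sum f               ≡⟨ sym (sum-map-tabulate f id) ⟩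
  sum (map f (allFin _))     ∎
  where open ≡.≡-Reasoning

bit : Bool → ℕ
bit b = if b then 1 else 0

bit≤1 : ∀ b → bit b ≤ 1
bit≤1 true  = ≤-refl
bit≤1 false = z≤n

bits≤1 : ∀ p q → ¬ (p ≡ true × q ≡ true) → bit p + bit q ≤ 1
bits≤1 true  true  ¬both = contradiction (refl , refl) ¬both
bits≤1 true  false _     = ≤-refl
bits≤1 false q     _     = bit≤1 q

module _ {n} (Y : Fin n → ℕ) where

  gap : Fin n → Fin n → ℕ
  gap u v = ∣ Y u - Y v ∣

  YDistinct : List (Fin n) → Set
  YDistinct vs = ∀ {u v} → u ∷ v ∷ [] ⊆ vs → Y u ≢ Y v

  gap≤maxStep : ∀ {J vs x z} → Linked (λ p q → gap p q ≤ J) vs → x ∷ z ∷ [] ⊆ vs →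
                (∀ {y} → x ∷ y ∷ z ∷ [] ⊆ vs → ¬ Between (Y x) (Y y) (Y z)) → gap x z ≤ J
  gap≤maxStep {J} {vs} {x} {z} steps τ avoids with <-cmp (Y x) (Y z)
  ... | tri< x<z _ _ =
    let p , q , p≤x , z≤q , pq≤J = crossing {P = λ c → Y c ≤ Y x} {Q = λ c → Y z ≤ Y c} steps τ
                                     (¬Between⇒outside x<z ∘ avoids) ≤-refl ≤-refl
    in ≤-trans (∣-∣-mono p≤x (<⇒≤ x<z) z≤q) pq≤J
  ... | tri≈ _ x≡z _ = subst (_≤ J) (sym (m≡n⇒∣m-n∣≡0 x≡z)) z≤n
  ... | tri> _ _ z<x =
    let p , q , x≤p , q≤z , pq≤J = crossing {P = λ c → Y x ≤ Y c} {Q = λ c → Y c ≤ Y z} steps τ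
                                     (⊎-swap ∘ ¬Between⇒outside z<x ∘ (_∘ Between-sym) ∘ avoids)
                                     ≤-refl ≤-refl
    in ≤-trans (subst₂ _≤_ (∣-∣-comm (Y z) (Y x)) (∣-∣-comm (Y q) (Y p))
                         (∣-∣-mono q≤z (<⇒≤ z<x) x≤p))
               pq≤J

module _ {n} (G : SimpleGraph n) where

  Edge-sym : ∀ {u v} → Edge G u v → Edge G v u
  Edge-sym {u} {v} e = ≡.trans (symm G v u) e

  degreeIn : Fin n → List (Fin n) → ℕ
  degreeIn u vs = sum (map (λ v → bit (adj G u v)) vs)

  edgesIn : List (Fin n) → ℕ
  edgesIn []       = 0
  edgesIn (u ∷ vs) = degreeIn u vs + edgesIn vs

  degreeIn≤length : ∀ u vs → degreeIn u vs ≤ length vs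
  degreeIn≤length u []       = z≤n
  degreeIn≤length u (v ∷ vs) = +-mono-≤ (bit≤1 (adj G u v)) (degreeIn≤length u vs)

  degreeIn-++ : ∀ u vs ws → degreeIn u (vs ++ ws) ≡ degreeIn u vs + degreeIn u ws
  degreeIn-++ u vs ws = ≡.trans (cong sum (map-++ edge vs ws)) (sum-++ (map edge vs) (map edge ws))
    where edge = λ v → bit (adj G u v)

  degreeIn-↭ : ∀ u {vs ws} → vs ↭ ws → degreeIn u vs ≡ degreeIn u ws
  degreeIn-↭ u p = sum-↭ (↭-map⁺ _ p)

  edgesIn-↭ : ∀ {vs ws} → vs ↭ ws → edgesIn vs ≡ edgesIn ws
  edgesIn-↭ refl         = refl
  edgesIn-↭ (prep x p)   = cong₂ _+_ (degreeIn-↭ x p) (edgesIn-↭ p)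
  edgesIn-↭ {_} {_ ∷ _ ∷ ws} (swap x y p)
    rewrite symm G x y | degreeIn-↭ x p | degreeIn-↭ y p | edgesIn-↭ p =
    interchange (bit (adj G y x)) (degreeIn x ws) (degreeIn y ws) (edgesIn ws)
  edgesIn-↭ (trans p q)  = ≡.trans (edgesIn-↭ p) (edgesIn-↭ q)

  degreeSum : List (Fin n) → List (Fin n) → ℕ
  degreeSum us vs = sum (map (λ u → degreeIn u vs) us)

  degreeSum-∷₂ : ∀ x us vs → degreeSum us (x ∷ vs) ≡ degreeIn x us + degreeSum us vs
  degreeSum-∷₂ x []       vs = refl
  degreeSum-∷₂ x (u ∷ us) vs rewrite degreeSum-∷₂ x us vs | symm G u x =
    interchange (bit (adj G x u)) (degreeIn u vs) (degreeIn x us) (degreeSum us vs)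

  handshake : ∀ vs → degreeSum vs vs ≡ 2 * edgesIn vs
  handshake []       = refl
  handshake (x ∷ vs) rewrite irrefl G x | degreeSum-∷₂ x vs vs | handshake vs =
    double (degreeIn x vs) (edgesIn vs)
    where
    double : ∀ d e → d + (d + 2 * e) ≡ 2 * (d + e)
    double = solve-∀

  edgesIn-inOrder : (π : LinearOrder n) → edgesIn (inOrder π) ≡ edgesIn (allFin n)
  edgesIn-inOrder π = *-cancelˡ-≡ _ _ 2 (begin
    2 * edgesIn (inOrder π)
      ≡⟨ sym (handshake (inOrder π)) ⟩
    degreeSum (inOrder π) (inOrder π)
      ≡⟨ cong sum (map-cong (λ u → sum-map-inOrder π (λ v → bit (adj G u v))) (inOrder π)) ⟩
    degreeSum (inOrder π) (allFin n)
      ≡⟨ sum-map-inOrder π (λ u → degreeIn u (allFin n)) ⟩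
    degreeSum (allFin n) (allFin n)
      ≡⟨ handshake (allFin n) ⟩
    2 * edgesIn (allFin n) ∎)
    where open ≡.≡-Reasoning

  upper : Fin n → Fin n → ℕ
  upper u v = if (toℕ u <ᵇ toℕ v) ∧ adj G u v then 1 else 0

  upper-< : ∀ {u v} → toℕ u < toℕ v → upper u v ≡ bit (adj G u v)
  upper-< {u} {v} u<v with toℕ u <ᵇ toℕ v | <⇒<ᵇ u<v
  ... | true | _ = refl

  upper-≥ : ∀ {u v} → toℕ v ≤ toℕ u → upper u v ≡ 0
  upper-≥ {u} {v} v≤u with toℕ u <ᵇ toℕ v | <ᵇ⇒< (toℕ u) (toℕ v)
  ... | false | _   = refl
  ... | true  | u<v = contradiction (u<v _) (≤⇒≯ v≤u)

  upperSum≡edgesIn : ∀ vs → AllPairs (λ u v → toℕ u < toℕ v) vs →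
                     sum (map (λ u → sum (map (upper u) vs)) vs) ≡ edgesIn vs
  upperSum≡edgesIn []       []              = refl
  upperSum≡edgesIn (x ∷ vs) (x<vs ∷ sorted) = cong₂ _+_
    (cong₂ _+_ (upper-≥ ≤-refl) (sum-map-cong (All.map upper-< x<vs)))
    (≡.trans (sum-map-cong (All.map (λ x<u → cong (_+ _) (upper-≥ (<⇒≤ x<u))) x<vs))
             (upperSum≡edgesIn vs sorted))

  edgeCount≡edgesIn : edgeCount G ≡ edgesIn (allFin n)
  edgeCount≡edgesIn = upperSum≡edgesIn (allFin n) (tabulate⁺-< id)

  module _ (a b : Fin n) where

    Common : Fin n → Set
    Common w = Edge G a w × Edge G b w

    common? : ∀ w → Dec (Common w)
    common? w = (adj G a w ≟ᵇ true) ×-dec (adj G b w ≟ᵇ true)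

    pairDegree-∷ : ∀ v vs → degreeIn a (v ∷ vs) + degreeIn b (v ∷ vs) ≡
                   (bit (adj G a v) + bit (adj G b v)) + (degreeIn a vs + degreeIn b vs)
    pairDegree-∷ v vs =
      interchange (bit (adj G a v)) (degreeIn a vs) (bit (adj G b v)) (degreeIn b vs)

    pairDegree≤length : ∀ vs → All (¬_ ∘ Common) vs → degreeIn a vs + degreeIn b vs ≤ length vs
    pairDegree≤length []       []            = z≤n
    pairDegree≤length (v ∷ vs) (¬common ∷ h) = ≤-trans (≤-reflexive (pairDegree-∷ v vs))
      (+-mono-≤ (bits≤1 _ _ ¬common) (pairDegree≤length vs h))

    pairDegree≤1+length : ∀ vs → (∀ {u v} → u ∷ v ∷ [] ⊆ vs → ¬ (Common u × Common v)) →
                          degreeIn a vs + degreeIn b vs ≤ suc (length vs)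
    pairDegree≤1+length []       _      = z≤n
    pairDegree≤1+length (v ∷ vs) unique =
      ≤-trans (≤-reflexive (pairDegree-∷ v vs)) (bound (common? v))
      where
      bound : Dec (Common v) →
              (bit (adj G a v) + bit (adj G b v)) + (degreeIn a vs + degreeIn b vs) ≤ 2 + length vs
      bound (yes common) = +-mono-≤ (+-mono-≤ (bit≤1 (adj G a v)) (bit≤1 (adj G b v)))
        (pairDegree≤length vs (All.tabulate λ w∈vs common′ →
          unique (refl ∷ from∈ w∈vs) (common , common′)))
      bound (no ¬common) =
        +-mono-≤ (bits≤1 _ _ ¬common) (pairDegree≤1+length vs (unique ∘ (v ∷ʳ_)))

  module _ (Y : Fin n → ℕ) where

    -- vs lists the vertices from left to right and Y gives their heights; a vertex lies inside the
    -- box spanned by u and v iff it comes between them in vs and its height is between theirs.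
    EmptyRectangles : List (Fin n) → Set
    EmptyRectangles vs = ∀ {u w v} → u ∷ w ∷ v ∷ [] ⊆ vs → Edge G u v → ¬ Between (Y u) (Y w) (Y v)

    module WidestPair {vs a b} (distinct : YDistinct Y vs) (empty : EmptyRectangles vs)
                      (steps : Linked (λ p q → gap Y p q ≤ gap Y a b) vs) where

      right-between : ∀ {w} → a ∷ b ∷ w ∷ [] ⊆ vs → Common a b w → Between (Y a) (Y w) (Y b)
      right-between {w} τ (aw , bw) = near⇒Between
        (distinct (⊆-trans (refl ∷ _ ∷ʳ refl ∷ []) τ))
        (distinct (∷ˡ⁻ τ))
        (empty τ aw)
        (subst (_≤ gap Y a b) (∣-∣-comm (Y b) (Y w))
          (gap≤maxStep Y steps (∷ˡ⁻ τ) (λ σ → empty σ bw)))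

      left-between : ∀ {w} → w ∷ a ∷ b ∷ [] ⊆ vs → Common a b w → Between (Y a) (Y w) (Y b)
      left-between {w} τ (aw , bw) = Between-sym (near⇒Between
        (≢-sym (distinct (⊆-trans (refl ∷ _ ∷ʳ refl ∷ []) τ)))
        (≢-sym (distinct (⊆-trans (refl ∷ refl ∷ _ ∷ʳ []) τ)))
        (empty τ (Edge-sym bw) ∘ Between-sym)
        (subst (gap Y w a ≤_) (∣-∣-comm (Y a) (Y b))
          (gap≤maxStep Y steps (⊆-trans (refl ∷ refl ∷ _ ∷ʳ []) τ) (λ σ → empty σ (Edge-sym aw)))))

      right-unique : ∀ {u v} → a ∷ b ∷ u ∷ v ∷ [] ⊆ vs → ¬ (Common a b u × Common a b v)
      right-unique ρ (common , (av , bv))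
        with Between-split (right-between (⊆-trans (refl ∷ refl ∷ refl ∷ _ ∷ʳ []) ρ) common)
                           (distinct (∷ˡ⁻ (∷ˡ⁻ ρ)))
      ... | inj₁ auv = empty (⊆-trans (refl ∷ _ ∷ʳ ⊆-refl) ρ) av auv
      ... | inj₂ vub = empty (∷ˡ⁻ ρ) bv (Between-sym vub)

      left-unique : ∀ {u v} → u ∷ v ∷ a ∷ b ∷ [] ⊆ vs → ¬ (Common a b u × Common a b v)
      left-unique ρ ((au , bu) , common)
        with Between-split (left-between (∷ˡ⁻ ρ) common)
                           (≢-sym (distinct (⊆-trans (refl ∷ refl ∷ _ ∷ʳ _ ∷ʳ []) ρ)))
      ... | inj₁ avu =
        empty (⊆-trans (refl ∷ refl ∷ refl ∷ _ ∷ʳ []) ρ) (Edge-sym au) (Between-sym avu)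
      ... | inj₂ uvb = empty (⊆-trans (refl ∷ refl ∷ _ ∷ʳ refl ∷ []) ρ) (Edge-sym bu) uvb

    removal-cost : ∀ P a b S → YDistinct Y (P ++ a ∷ b ∷ S) → EmptyRectangles (P ++ a ∷ b ∷ S) →
                   Linked (λ p q → gap Y p q ≤ gap Y a b) (P ++ a ∷ b ∷ S) →
                   edgesIn (P ++ a ∷ b ∷ S) ≤ edgesIn (P ++ S) + (length (P ++ S) + 3)
    removal-cost P a b S distinct empty steps = begin
      edgesIn (P ++ a ∷ b ∷ S)
        ≡⟨ edgesIn-↭ (removePair-↭ P a b S) ⟩
      (bit (adj G a b) + degreeIn a (P ++ S)) + (degreeIn b (P ++ S) + edgesIn (P ++ S))
        ≡⟨ regroup (bit (adj G a b)) (degreeIn a (P ++ S)) (degreeIn b (P ++ S))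
                   (edgesIn (P ++ S)) ⟩
      edgesIn (P ++ S) + (bit (adj G a b) + (degreeIn a (P ++ S) + degreeIn b (P ++ S)))
        ≤⟨ +-monoʳ-≤ (edgesIn (P ++ S)) (+-mono-≤ (bit≤1 (adj G a b)) pairDegree≤) ⟩
      edgesIn (P ++ S) + (1 + (suc (length P) + suc (length S)))
        ≡⟨ cong (λ l → edgesIn (P ++ S) + l) (count (length P) (length S)) ⟩
      edgesIn (P ++ S) + (length P + length S + 3)
        ≡⟨ cong (λ l → edgesIn (P ++ S) + (l + 3)) (sym (length-++ P)) ⟩
      edgesIn (P ++ S) + (length (P ++ S) + 3) ∎
      where
      open ≤-Reasoning
      open WidestPair distinct empty steps

      regroup : ∀ e x y r → (e + x) + (y + r) ≡ r + (e + (x + y))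
      regroup = solve-∀

      count : ∀ p s → 1 + (suc p + suc s) ≡ p + s + 3
      count = solve-∀

      pairDegree≤ : degreeIn a (P ++ S) + degreeIn b (P ++ S) ≤ suc (length P) + suc (length S)
      pairDegree≤ = begin
        degreeIn a (P ++ S) + degreeIn b (P ++ S)
          ≡⟨ cong₂ _+_ (degreeIn-++ a P S) (degreeIn-++ b P S) ⟩
        (degreeIn a P + degreeIn a S) + (degreeIn b P + degreeIn b S)
          ≡⟨ interchange (degreeIn a P) (degreeIn a S) (degreeIn b P) (degreeIn b S) ⟩
        (degreeIn a P + degreeIn b P) + (degreeIn a S + degreeIn b S)
          ≤⟨ +-mono-≤
               (pairDegree≤1+length a b P (λ σ → left-unique (++⁺ σ (refl ∷ refl ∷ minimum S))))
               (pairDegree≤1+length a b S (λ σ → right-unique (++⁺ˡ P (refl ∷ refl ∷ σ)))) ⟩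
        suc (length P) + suc (length S) ∎

    edgesIn-bound : ∀ k vs → length vs ≡ 2 + k → YDistinct Y vs → EmptyRectangles vs →
                    4 * edgesIn vs + 8 ≤ length vs * length vs + 4 * length vs
    edgesIn-bound 0 (a ∷ b ∷ []) _ _ _ =
      +-monoˡ-≤ 8 (*-monoʳ-≤ 4 (+-monoˡ-≤ 0 (degreeIn≤length a (b ∷ []))))
    edgesIn-bound 1 (a ∷ b ∷ c ∷ []) _ _ _ = ≤-trans
      (+-monoˡ-≤ 8 (*-monoʳ-≤ 4 (+-mono-≤ (degreeIn≤length a (b ∷ c ∷ []))
                                          (+-monoˡ-≤ 0 (degreeIn≤length b (c ∷ []))))))
      (n≤1+n 20)
    edgesIn-bound (suc (suc k)) (x ∷ y ∷ zs) = removeWidest (widestStep (gap Y) x y zs)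
      where
      removeWidest : ∀ {vs} → WidestStep (gap Y) vs → length vs ≡ 4 + k →
                     YDistinct Y vs → EmptyRectangles vs →
                     4 * edgesIn vs + 8 ≤ length vs * length vs + 4 * length vs
      removeWidest (widest P a b S refl steps) length≡4+k distinct empty = begin
        4 * edgesIn (P ++ a ∷ b ∷ S) + 8
          ≤⟨ +-monoˡ-≤ 8 (*-monoʳ-≤ 4 (removal-cost P a b S distinct empty steps)) ⟩
        4 * (edgesIn (P ++ S) + (m + 3)) + 8
          ≡⟨ split-off (edgesIn (P ++ S)) m ⟩
        (4 * edgesIn (P ++ S) + 8) + (4 * m + 12)
          ≤⟨ +-monoˡ-≤ (4 * m + 12)
               (edgesIn-bound k (P ++ S) m≡2+k (distinct ∘ shrink) (empty ∘ shrink)) ⟩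
        (m * m + 4 * m) + (4 * m + 12)
          ≡⟨ grow m ⟩
        (2 + m) * (2 + m) + 4 * (2 + m)
          ≡⟨ cong (λ l → l * l + 4 * l) (sym length-removed) ⟩
        length (P ++ a ∷ b ∷ S) * length (P ++ a ∷ b ∷ S) + 4 * length (P ++ a ∷ b ∷ S) ∎
        where
        open ≤-Reasoning
        m = length (P ++ S)

        length-removed : length (P ++ a ∷ b ∷ S) ≡ 2 + m
        length-removed = ↭-length (removePair-↭ P a b S)

        m≡2+k : m ≡ 2 + k
        m≡2+k = suc-injective (suc-injective (≡.trans (sym length-removed) length≡4+k))

        shrink : ∀ {us} → us ⊆ P ++ S → us ⊆ P ++ a ∷ b ∷ S
        shrink σ = ⊆-trans σ (++⁺ ⊆-refl (a ∷ʳ b ∷ʳ ⊆-refl))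

        split-off : ∀ e m → 4 * (e + (m + 3)) + 8 ≡ (4 * e + 8) + (4 * m + 12)
        split-off = solve-∀

        grow : ∀ m → (m * m + 4 * m) + (4 * m + 12) ≡ (2 + m) * (2 + m) + 4 * (2 + m)
        grow = solve-∀

    edgesIn-bound _ []                    ()
    edgesIn-bound _ (_ ∷ [])              ()
    edgesIn-bound 0 (_ ∷ _ ∷ _ ∷ _)       ()
    edgesIn-bound 1 (_ ∷ _ ∷ [])          ()
    edgesIn-bound 1 (_ ∷ _ ∷ _ ∷ _ ∷ _)   ()

inOrder-sorted : ∀ {n} (π : LinearOrder n) →
                 AllPairs (λ u v → position π u < position π v) (inOrder π)
inOrder-sorted π = tabulate⁺-< λ i<j →
  subst₂ _<_ (sym (cong toℕ (inverseʳ π))) (sym (cong toℕ (inverseʳ π))) i<j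

position-injective : ∀ {n} (π : LinearOrder n) {u v} → position π u ≡ position π v → u ≡ v
position-injective π {u} {v} eq =
  ≡.trans (sym (inverseˡ π)) (≡.trans (cong (π ⟨$⟩ˡ_) (toℕ-injective eq)) (inverseˡ π))

position-distinct : ∀ {n} (π₁ π₂ : LinearOrder n) → YDistinct (position π₂) (inOrder π₁)
position-distinct π₁ π₂ σ eq =
  <-irrefl (cong (position π₁) (position-injective π₂ eq)) (AllPairs-⊆ (inOrder-sorted π₁) σ)

rev-reverses : ∀ {n} (π : LinearOrder n) {x y} → x >⟨ rev π ⟩ y → y >⟨ π ⟩ x
rev-reverses {n} π {x} {y} x>y = ≤-pred (∸-cancelʳ-< {o = n}
  (subst₂ _<_ (opposite-prop (π ⟨$⟩ʳ y)) (opposite-prop (π ⟨$⟩ʳ x)) x>y))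

module _ {n} (G : SimpleGraph n) {π₁ π₂ : LinearOrder n}
         (realizer : IsRealizer G (π₁ ∷ π₂ ∷ rev π₁ ∷ rev π₂ ∷ [])) where

  realizer⇒¬Between : ∀ {u w v} → Edge G u v →
                      position π₁ u < position π₁ w → position π₁ w < position π₁ v →
                      ¬ Between (position π₂ u) (position π₂ w) (position π₂ v)
  realizer⇒¬Between {u} {w} {v} uv u<w w<v
    with realizer u v w uv (λ { refl → <-irrefl refl u<w }) (λ { refl → <-irrefl refl w<v })
  ... | _ , here refl , _ , w>v = contradiction w>v (<⇒≯ w<v)
  ... | _ , there (here refl) , w>u , w>v = max-¬Between w>u w>v
  ... | _ , there (there (here refl)) , w>u , _ = contradiction (rev-reverses π₁ w>u) (<⇒≯ u<w)
  ... | _ , there (there (there (here refl))) , w>u , w>v =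
    min-¬Between (rev-reverses π₂ w>u) (rev-reverses π₂ w>v)
  ... | _ , there (there (there (there ()))) , _

  realizer⇒EmptyRectangles : EmptyRectangles G (position π₂) (inOrder π₁)
  realizer⇒EmptyRectangles τ uv = realizer⇒¬Between uv
    (AllPairs-⊆ (inOrder-sorted π₁) (⊆-trans (refl ∷ refl ∷ _ ∷ʳ []) τ))
    (AllPairs-⊆ (inOrder-sorted π₁) (∷ˡ⁻ τ))

4*e+8≤m⇒e≤[m∸8]/4 : ∀ {e m} → 4 * e + 8 ≤ m → e ≤ (m ∸ 8) / 4
4*e+8≤m⇒e≤[m∸8]/4 {e} {m} 4e+8≤m = begin
  e           ≡⟨ sym (m*n/n≡m e 4) ⟩
  e * 4 / 4   ≤⟨ /-monoˡ-≤ 4 (subst (_≤ m ∸ 8) (*-comm 4 e) (m+n≤o⇒m≤o∸n (4 * e) 4e+8≤m)) ⟩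
  (m ∸ 8) / 4 ∎
  where open ≤-Reasoning

corollary6 : ∀ (n : ℕ) (G : SimpleGraph n) → 3 ≤ n → Connected G → Dim3to4 G →
    edgeCount G ≤ (n * n + 4 * n ∸ 8) / 4
corollary6 n@(suc (suc k)) G _ _ (π₁ , π₂ , realizer) = 4*e+8≤m⇒e≤[m∸8]/4 (begin
  4 * edgeCount G + 8
    ≡⟨ cong (λ e → 4 * e + 8) (≡.trans (edgeCount≡edgesIn G) (sym (edgesIn-inOrder G π₁))) ⟩
  4 * edgesIn G (inOrder π₁) + 8
    ≤⟨ edgesIn-bound G (position π₂) k (inOrder π₁) (length-tabulate (π₁ ⟨$⟩ˡ_))
                     (position-distinct π₁ π₂) (realizer⇒EmptyRectangles G realizer) ⟩
  length (inOrder π₁) * length (inOrder π₁) + 4 * length (inOrder π₁)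
    ≡⟨ cong (λ l → l * l + 4 * l) (length-tabulate (π₁ ⟨$⟩ˡ_)) ⟩
  n * n + 4 * n ∎)
  where open ≤-Reasoning
corollary6 0 _ ()       _ _
corollary6 1 _ (s≤s ()) _ _
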